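{- For any Łukasiewicz near semiring $\mathbf A$, the ideal lattice $\mathrm{Id}(\mathbf A)$ is pseudocomplemented: for every ideal $J$ there is a greatest ideal $I$ with $J\cap I=\{0\}$.
   Context: An $\iota$-near semiring is an algebra $\langle A,+,\cdot,{}^{\alpha},0,1\rangle$ of type $\langle 2,2,1,0,0\rangle$ such that $\langle A,+\rangle$ is a join semilattice with least element $0$ and greatest element $1$ (order $x\le y$ iff $x+y=y$), $x\cdot1=x=1\cdot x$, $(x+y)\cdot z=xz+yz$, $x0=0x=0$, $(x^{\alpha})^{\alpha}=x$, and $x\le y$ implies $y^{\alpha}\le x^{\alpha}$. A Łukasiewicz near semiring is an $\iota$-near semiring satisfying $(x y^{\alpha})^{\alpha} y^{\alpha}=(y x^{\alpha})^{\alpha} x^{\alpha}$. Juxtaposition $xy$ denotes $x\cdot y$. An ideal of $\mathbf A$ is a set $I\subseteq A$ with $0\in I$ such that (I1) if $ab^{\alpha}\in I$ and $b\in I$ then $a\in I$; (I2) if $a^{\alpha}b\in I$ and $b^{\alpha}a\in I$ then $(ac)^{\alpha}(bc)\in I$ and $(ca)^{\alpha}(cb)\in I$ for every $c\in A$. $\mathrm{Id}(\mathbf A)$ is the lattice of ideals ordered by inclusion. -}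

module Defs where

open import Level using (Level; suc; _⊔_)
open import Relation.Binary.PropositionalEquality using (_≡_)
open import Data.Product using (_×_; Σ; _,_)
open import Relation.Unary using (Pred; _⊆_; _∈_)

record IotaNearSemiring (a : Level) : Set (suc a) where
  infixl 6 _+_
  infixl 7 _·_
  field
    Carrier : Set a
    _+_     : Carrier → Carrier → Carrier
    _·_     : Carrier → Carrier → Carrier
    _ᵅ      : Carrier → Carrier
    𝟘 𝟙     : Carrier

  _≤_ : Carrier → Carrier → Set a
  x ≤ y = x + y ≡ y

  field
    +-assoc : ∀ x y z → (x + y) + z ≡ x + (y + z)
    +-comm  : ∀ x y → x + y ≡ y + x
    +-idem  : ∀ x → x + x ≡ x
    0-least    : ∀ x → 𝟘 ≤ x
    1-greatest : ∀ x → x ≤ 𝟙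
    ·-identityʳ : ∀ x → x · 𝟙 ≡ x
    ·-identityˡ : ∀ x → 𝟙 · x ≡ x
    distribʳ : ∀ x y z → (x + y) · z ≡ x · z + y · z
    zeroʳ : ∀ x → x · 𝟘 ≡ 𝟘
    zeroˡ : ∀ x → 𝟘 · x ≡ 𝟘
    ᵅ-invol : ∀ x → (x ᵅ) ᵅ ≡ x
    ᵅ-antitone : ∀ x y → x ≤ y → (y ᵅ) ≤ (x ᵅ)

record ŁukasiewiczNearSemiring (a : Level) : Set (suc a) where
  field
    nearSemiring : IotaNearSemiring a
  open IotaNearSemiring nearSemiring public
  field
    łuk : ∀ x y → ((x · (y ᵅ)) ᵅ) · (y ᵅ) ≡ ((y · (x ᵅ)) ᵅ) · (x ᵅ)

module _ {a : Level} (A : ŁukasiewiczNearSemiring a) where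
  open ŁukasiewiczNearSemiring A

  record IsIdeal {ℓ : Level} (I : Pred Carrier ℓ) : Set (a ⊔ ℓ) where
    field
      zero∈ : 𝟘 ∈ I
      I1 : ∀ x y → (x · (y ᵅ)) ∈ I → y ∈ I → x ∈ I
      I2 : ∀ x y → ((x ᵅ) · y) ∈ I → ((y ᵅ) · x) ∈ I →
           ∀ c → (((x · c) ᵅ) · (y · c)) ∈ I × (((c · x) ᵅ) · (c · y)) ∈ I

  -- J ∩ I = {0}  (0 lies in every ideal, so only ⊆ {0} needs stating).
  MeetIsZero : {ℓ : Level} → Pred Carrier ℓ → Pred Carrier ℓ → Set (a ⊔ ℓ)
  MeetIsZero J I = ∀ x → x ∈ J → x ∈ I → x ≡ 𝟘

  IsPseudocomplement : {ℓ : Level} → Pred Carrier ℓ → Pred Carrier ℓ → Set (a ⊔ suc ℓ)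
  IsPseudocomplement {ℓ} J I =
    IsIdeal I × MeetIsZero J I ×
    (∀ (K : Pred Carrier ℓ) → IsIdeal K → MeetIsZero J K → K ⊆ I)

-- The pseudocomplement of an ideal J in Id(A) is built from congruences.
--
-- Call u ∈ A J-separating when the principal congruence Cg(u) generated by
-- (u,0) identifies no two distinct elements of J.  Let Θ be the join of all
-- Cg(u) with u J-separating, and let J⊥ = {x | x Θ 0}, its kernel.
--   * The kernel of any congruence is an ideal, because x ≡ y follows from
--     xᵅy ≡ 0 and yᵅx ≡ 0 modulo a congruence (residual antisymmetry).
--   * J ∩ J⊥ = {0}: with z ⊓ c = (zᵅc)ᵅc, the map c ↦ z ⊓ c preserves
--     congruences and lands below z, so for z ∈ J it cannot separate
--     Θ-related elements; z Θ 0 then gives z = z ⊓ z = z ⊓ 0 = 0.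
--   * J⊥ is greatest: an ideal K with J ∩ K = {0} induces a congruence θ_K
--     (x θ_K y iff xᵅy, yᵅx ∈ K) which identifies no two distinct elements
--     of J.  For u ∈ K we have Cg(u) ⊆ θ_K, so u is J-separating and u ∈ J⊥.
module Submission where

open import Defs
open import Level using (Level; _⊔_)
open import Data.Product using (Σ; _,_; _×_; proj₁; proj₂)
open import Relation.Unary using (Pred)
open import Relation.Binary.Core using (Rel; _⇒_)
open import Relation.Binary.Structures using (IsEquivalence)
open import Relation.Binary.PropositionalEquality
  using (_≡_; refl; sym; trans; cong; subst; module ≡-Reasoning)
  renaming (isEquivalence to ≡-isEquivalence)

module IotaFacts {a : Level} (N : IotaNearSemiring a) where
  open IotaNearSemiring N

  ≤-antisym : ∀ {x y} → x ≤ y → y ≤ x → x ≡ y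
  ≤-antisym {x} {y} x≤y y≤x = trans (sym y≤x) (trans (+-comm y x) x≤y)

  ≤𝟘⇒≡𝟘 : ∀ {x} → x ≤ 𝟘 → x ≡ 𝟘
  ≤𝟘⇒≡𝟘 {x} x≤𝟘 = ≤-antisym x≤𝟘 (0-least x)

  𝟘ᵅ≡𝟙 : 𝟘 ᵅ ≡ 𝟙
  𝟘ᵅ≡𝟙 = ≤-antisym (1-greatest (𝟘 ᵅ)) 𝟙≤𝟘ᵅ
    where
      𝟙≤𝟘ᵅ : 𝟙 ≤ (𝟘 ᵅ)
      𝟙≤𝟘ᵅ = subst (_≤ (𝟘 ᵅ)) (ᵅ-invol 𝟙) (ᵅ-antitone 𝟘 (𝟙 ᵅ) (0-least (𝟙 ᵅ)))

  𝟙ᵅ≡𝟘 : 𝟙 ᵅ ≡ 𝟘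
  𝟙ᵅ≡𝟘 = trans (cong _ᵅ (sym 𝟘ᵅ≡𝟙)) (ᵅ-invol 𝟘)

  𝟘ᵅ-identityˡ : ∀ x → 𝟘 ᵅ · x ≡ x
  𝟘ᵅ-identityˡ x = trans (cong (_· x) 𝟘ᵅ≡𝟙) (·-identityˡ x)

  𝟘ᵅ-identityʳ : ∀ x → x · 𝟘 ᵅ ≡ x
  𝟘ᵅ-identityʳ x = trans (cong (x ·_) 𝟘ᵅ≡𝟙) (·-identityʳ x)

  ·-monoˡ-≤ : ∀ {x y} z → x ≤ y → (x · z) ≤ (y · z)
  ·-monoˡ-≤ {x} {y} z x≤y = trans (sym (distribʳ x y z)) (cong (_· z) x≤y)

  x·y≤y : ∀ x y → (x · y) ≤ y
  x·y≤y x y = subst ((x · y) ≤_) (·-identityˡ y) (·-monoˡ-≤ y (1-greatest x))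

  -- Equivalence relations compatible with all non-constant operations.
  record IsCongruence {ℓ : Level} (R : Rel Carrier ℓ) : Set (a ⊔ ℓ) where
    field
      isEquivalence : IsEquivalence R
      ᵅ-cong  : ∀ {x y} → R x y → R (x ᵅ) (y ᵅ)
      ·-congˡ : ∀ c {x y} → R x y → R (c · x) (c · y)
      ·-congʳ : ∀ c {x y} → R x y → R (x · c) (y · c)
    open IsEquivalence isEquivalence public

  ≡-isCongruence : IsCongruence _≡_
  ≡-isCongruence = record
    { isEquivalence = ≡-isEquivalence
    ; ᵅ-cong  = cong _ᵅ
    ; ·-congˡ = λ c → cong (c ·_)
    ; ·-congʳ = λ c → cong (_· c)
    }

module ŁukasiewiczFacts {a : Level} (A : ŁukasiewiczNearSemiring a) where
  open ŁukasiewiczNearSemiring A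
  open IotaFacts nearSemiring
  open ≡-Reasoning

  x·xᵅ≡𝟘 : ∀ x → x · x ᵅ ≡ 𝟘
  x·xᵅ≡𝟘 x = begin
    x · x ᵅ                 ≡⟨ cong (_· x ᵅ) (ᵅ-invol x) ⟨
    x ᵅ ᵅ · x ᵅ             ≡⟨ cong (λ w → w ᵅ · x ᵅ) (·-identityˡ (x ᵅ)) ⟨
    (𝟙 · x ᵅ) ᵅ · x ᵅ       ≡⟨ łuk x 𝟙 ⟨
    (x · 𝟙 ᵅ) ᵅ · 𝟙 ᵅ       ≡⟨ cong (λ w → (x · w) ᵅ · w) 𝟙ᵅ≡𝟘 ⟩
    (x · 𝟘) ᵅ · 𝟘           ≡⟨ zeroʳ _ ⟩
    𝟘                       ∎

  xᵅ·x≡𝟘 : ∀ x → x ᵅ · x ≡ 𝟘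
  xᵅ·x≡𝟘 x = trans (cong (x ᵅ ·_) (sym (ᵅ-invol x))) (x·xᵅ≡𝟘 (x ᵅ))

  łuk-dual : ∀ x y → (x ᵅ · y) ᵅ · y ≡ (y ᵅ · x) ᵅ · x
  łuk-dual x y = begin
    (x ᵅ · y) ᵅ · y             ≡⟨ cong (λ w → (x ᵅ · w) ᵅ · w) (ᵅ-invol y) ⟨
    (x ᵅ · y ᵅ ᵅ) ᵅ · y ᵅ ᵅ     ≡⟨ łuk (x ᵅ) (y ᵅ) ⟩
    (y ᵅ · x ᵅ ᵅ) ᵅ · x ᵅ ᵅ     ≡⟨ cong (λ w → (y ᵅ · w) ᵅ · w) (ᵅ-invol x) ⟩
    (y ᵅ · x) ᵅ · x             ∎

  -- A meet-like operation (the lattice meet in MV-algebras).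
  infixl 7 _⊓_
  _⊓_ : Carrier → Carrier → Carrier
  z ⊓ c = (z ᵅ · c) ᵅ · c

  ⊓-lowerˡ : ∀ z c → (z ⊓ c) ≤ z
  ⊓-lowerˡ z c = subst (_≤ z) (sym (łuk-dual z c)) (x·y≤y _ z)

  ⊓-idem : ∀ z → z ⊓ z ≡ z
  ⊓-idem z = trans (cong (λ w → w ᵅ · z) (xᵅ·x≡𝟘 z)) (𝟘ᵅ-identityˡ z)

  ⊓-zeroʳ : ∀ z → z ⊓ 𝟘 ≡ 𝟘
  ⊓-zeroʳ z = zeroʳ _

  module _ {ℓ : Level} {R : Rel Carrier ℓ} (isCong : IsCongruence R) where
    open IsCongruence isCong
      renaming (refl to ~-refl; sym to ~-sym; trans to ~-trans; reflexive to ~-reflexive)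

    -- Residual antisymmetry modulo a congruence:
    -- y = 0ᵅy ~ (xᵅy)ᵅy = (yᵅx)ᵅx ~ 0ᵅx = x.
    residual-antisym : ∀ {x y} → R (x ᵅ · y) 𝟘 → R (y ᵅ · x) 𝟘 → R x y
    residual-antisym {x} {y} xᵅy~𝟘 yᵅx~𝟘 =
      ~-sym (~-trans y~ (~-trans (~-reflexive (łuk-dual x y)) (~-sym x~)))
      where
        y~ : R y ((x ᵅ · y) ᵅ · y)
        y~ = ~-trans (~-reflexive (sym (𝟘ᵅ-identityˡ y))) (·-congʳ y (ᵅ-cong (~-sym xᵅy~𝟘)))
        x~ : R x ((y ᵅ · x) ᵅ · x)
        x~ = ~-trans (~-reflexive (sym (𝟘ᵅ-identityˡ x))) (·-congʳ x (ᵅ-cong (~-sym yᵅx~𝟘)))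

    ⊓-congʳ : ∀ z {c c'} → R c c' → R (z ⊓ c) (z ⊓ c')
    ⊓-congʳ z {c} c~c' = ~-trans (·-congʳ c (ᵅ-cong (·-congˡ (z ᵅ) c~c'))) (·-congˡ _ c~c')

    kernel : Pred Carrier ℓ
    kernel x = R x 𝟘

    kernel-isIdeal : IsIdeal A kernel
    kernel-isIdeal = record { zero∈ = ~-refl ; I1 = kernel-I1 ; I2 = kernel-I2 }
      where
        -- x = x·0ᵅ ~ x·yᵅ ~ 0
        kernel-I1 : ∀ x y → R (x · y ᵅ) 𝟘 → R y 𝟘 → R x 𝟘
        kernel-I1 x y x·yᵅ~𝟘 y~𝟘 =
          ~-trans (~-trans (~-reflexive (sym (𝟘ᵅ-identityʳ x))) (·-congˡ x (ᵅ-cong (~-sym y~𝟘)))) x·yᵅ~𝟘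
        -- x ~ y, so (xc)ᵅ(yc) ~ (yc)ᵅ(yc) = 0, and likewise on the left.
        kernel-I2 : ∀ x y → R (x ᵅ · y) 𝟘 → R (y ᵅ · x) 𝟘 → ∀ c →
                    R ((x · c) ᵅ · (y · c)) 𝟘 × R ((c · x) ᵅ · (c · y)) 𝟘
        kernel-I2 x y xᵅy~𝟘 yᵅx~𝟘 c =
            ~-trans (·-congʳ (y · c) (ᵅ-cong (·-congʳ c x~y))) (~-reflexive (xᵅ·x≡𝟘 _))
          , ~-trans (·-congʳ (c · y) (ᵅ-cong (·-congˡ c x~y))) (~-reflexive (xᵅ·x≡𝟘 _))
          where
            x~y : R x y
            x~y = residual-antisym xᵅy~𝟘 yᵅx~𝟘

  residual-antisym-≡ : ∀ {x y} → x ᵅ · y ≡ 𝟘 → y ᵅ · x ≡ 𝟘 → x ≡ y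
  residual-antisym-≡ = residual-antisym ≡-isCongruence

module IdealCongruence {a ℓ : Level} (A : ŁukasiewiczNearSemiring a)
                       {K : Pred (ŁukasiewiczNearSemiring.Carrier A) ℓ} (isK : IsIdeal A K) where
  open ŁukasiewiczNearSemiring A
  open IotaFacts nearSemiring
  open ŁukasiewiczFacts A
  open IsIdeal isK

  -- x ≤ y gives x·yᵅ ≤ y·yᵅ = 0, so (I1) applies.
  downward-closed : ∀ {x y} → x ≤ y → K y → K x
  downward-closed {x} {y} x≤y y∈K = I1 x y (subst K (sym x·yᵅ≡𝟘) zero∈) y∈K
    where
      x·yᵅ≡𝟘 : x · y ᵅ ≡ 𝟘
      x·yᵅ≡𝟘 = ≤𝟘⇒≡𝟘 (subst ((x · y ᵅ) ≤_) (x·xᵅ≡𝟘 y) (·-monoˡ-≤ (y ᵅ) x≤y))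

  -- (I2) with the pair (0, w) shows that K absorbs left multiplication.
  ·-closedˡ : ∀ c {w} → K w → K (c · w)
  ·-closedˡ c {w} w∈K =
    subst K (trans (cong (λ v → v ᵅ · (c · w)) (zeroʳ c)) (𝟘ᵅ-identityˡ _))
          (proj₂ (I2 𝟘 w (subst K (sym (𝟘ᵅ-identityˡ w)) w∈K) (subst K (sym (zeroʳ _)) zero∈) c))

  θ : Rel Carrier ℓ
  θ x y = K (x ᵅ · y) × K (y ᵅ · x)

  θ-ofElement : ∀ {u} → K u → θ u 𝟘
  θ-ofElement u∈K = subst K (sym (zeroʳ _)) zero∈ , subst K (sym (𝟘ᵅ-identityˡ _)) u∈K

  θ-isCongruence : IsCongruence θ
  θ-isCongruence = record
    { isEquivalence = record { refl = θ-refl ; sym = θ-sym ; trans = θ-trans }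
    ; ᵅ-cong  = θ-ᵅ
    ; ·-congˡ = θ-l
    ; ·-congʳ = θ-r
    }
    where
      θ-refl : ∀ {x} → θ x x
      θ-refl {x} = subst K (sym (xᵅ·x≡𝟘 x)) zero∈ , subst K (sym (xᵅ·x≡𝟘 x)) zero∈

      θ-sym : ∀ {x y} → θ x y → θ y x
      θ-sym (xᵅy , yᵅx) = yᵅx , xᵅy

      θ-r : ∀ c {x y} → θ x y → θ (x · c) (y · c)
      θ-r c {x} {y} (xᵅy , yᵅx) = proj₁ (I2 x y xᵅy yᵅx c) , proj₁ (I2 y x yᵅx xᵅy c)

      θ-l : ∀ c {x y} → θ x y → θ (c · x) (c · y)
      θ-l c {x} {y} (xᵅy , yᵅx) = proj₂ (I2 x y xᵅy yᵅx c) , proj₂ (I2 y x yᵅx xᵅy c)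

      -- Multiplying x θ y on the right by yᵅ gives (yyᵅ)ᵅ(xyᵅ) = xyᵅ ∈ K.
      x·yᵅ∈K : ∀ {x y} → θ x y → K (x · y ᵅ)
      x·yᵅ∈K {x} {y} x~y =
        subst K (trans (cong (λ v → v ᵅ · (x · y ᵅ)) (x·xᵅ≡𝟘 y)) (𝟘ᵅ-identityˡ _))
              (proj₂ (θ-r (y ᵅ) x~y))

      θ-ᵅ : ∀ {x y} → θ x y → θ (x ᵅ) (y ᵅ)
      θ-ᵅ {x} {y} x~y = subst K (cong (_· y ᵅ) (sym (ᵅ-invol x))) (x·yᵅ∈K x~y)
                      , subst K (cong (_· x ᵅ) (sym (ᵅ-invol y))) (x·yᵅ∈K (θ-sym x~y))

      -- From xᵅy ∈ K and (xᵅz)(xᵅy)ᵅ ∈ K (the latter from xᵅz θ xᵅy), (I1) gives xᵅz ∈ K.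
      θ-trans-half : ∀ {x y z} → θ x y → θ y z → K (x ᵅ · z)
      θ-trans-half {x} {y} {z} x~y y~z =
        I1 (x ᵅ · z) (x ᵅ · y) (x·yᵅ∈K (θ-sym (θ-l (x ᵅ) y~z))) (proj₁ x~y)

      θ-trans : ∀ {x y z} → θ x y → θ y z → θ x z
      θ-trans x~y y~z = θ-trans-half x~y y~z , θ-trans-half (θ-sym y~z) (θ-sym x~y)

module PrincipalCongruence {a : Level} (A : ŁukasiewiczNearSemiring a) where
  open ŁukasiewiczNearSemiring A
  open IotaFacts nearSemiring

  data Cg (u : Carrier) : Rel Carrier a where
    generator : Cg u u 𝟘
    cg-refl   : ∀ {x} → Cg u x x
    cg-sym    : ∀ {x y} → Cg u x y → Cg u y x
    cg-trans  : ∀ {x y z} → Cg u x y → Cg u y z → Cg u x z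
    cg-ᵅ      : ∀ {x y} → Cg u x y → Cg u (x ᵅ) (y ᵅ)
    cg-l      : ∀ c {x y} → Cg u x y → Cg u (c · x) (c · y)
    cg-r      : ∀ c {x y} → Cg u x y → Cg u (x · c) (y · c)

  Cg-least : ∀ {ℓ} {R : Rel Carrier ℓ} {u} → IsCongruence R → R u 𝟘 → Cg u ⇒ R
  Cg-least isCong u~𝟘 = go
    where
      open IsCongruence isCong renaming (refl to ~-refl; sym to ~-sym; trans to ~-trans)
      go : Cg _ ⇒ _
      go generator        = u~𝟘
      go cg-refl          = ~-refl
      go (cg-sym h)       = ~-sym (go h)
      go (cg-trans h h')  = ~-trans (go h) (go h')
      go (cg-ᵅ h)         = ᵅ-cong (go h)
      go (cg-l c h)       = ·-congˡ c (go h)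
      go (cg-r c h)       = ·-congʳ c (go h)

  Cg-isCongruence : ∀ {u} → IsCongruence (Cg u)
  Cg-isCongruence = record
    { isEquivalence = record { refl = cg-refl ; sym = cg-sym ; trans = cg-trans }
    ; ᵅ-cong  = cg-ᵅ
    ; ·-congˡ = cg-l
    ; ·-congʳ = cg-r
    }

module Pseudocomplement {a : Level} (A : ŁukasiewiczNearSemiring a)
                        (J : Pred (ŁukasiewiczNearSemiring.Carrier A) a) (isJ : IsIdeal A J) where
  open ŁukasiewiczNearSemiring A
  open IotaFacts nearSemiring
  open ŁukasiewiczFacts A
  open PrincipalCongruence A
  open IdealCongruence A isJ using (downward-closed; ·-closedˡ)

  Separating : Carrier → Set a
  Separating u = ∀ {p q} → Cg u p q → J p → J q → p ≡ q

  -- The join of the principal congruences of all separating elements.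
  data Θ : Rel Carrier a where
    Θ-refl  : ∀ {x} → Θ x x
    Θ-base  : ∀ {u x y} → Separating u → Cg u x y → Θ x y
    Θ-trans : ∀ {x y z} → Θ x y → Θ y z → Θ x z

  Θ-isCongruence : IsCongruence Θ
  Θ-isCongruence = record
    { isEquivalence = record { refl = Θ-refl ; sym = Θ-sym ; trans = Θ-trans }
    ; ᵅ-cong  = Θ-ᵅ
    ; ·-congˡ = Θ-l
    ; ·-congʳ = Θ-r
    }
    where
      Θ-sym : ∀ {x y} → Θ x y → Θ y x
      Θ-sym Θ-refl          = Θ-refl
      Θ-sym (Θ-base s h)    = Θ-base s (cg-sym h)
      Θ-sym (Θ-trans h h')  = Θ-trans (Θ-sym h') (Θ-sym h)

      Θ-ᵅ : ∀ {x y} → Θ x y → Θ (x ᵅ) (y ᵅ)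
      Θ-ᵅ Θ-refl          = Θ-refl
      Θ-ᵅ (Θ-base s h)    = Θ-base s (cg-ᵅ h)
      Θ-ᵅ (Θ-trans h h')  = Θ-trans (Θ-ᵅ h) (Θ-ᵅ h')

      Θ-l : ∀ c {x y} → Θ x y → Θ (c · x) (c · y)
      Θ-l c Θ-refl          = Θ-refl
      Θ-l c (Θ-base s h)    = Θ-base s (cg-l c h)
      Θ-l c (Θ-trans h h')  = Θ-trans (Θ-l c h) (Θ-l c h')

      Θ-r : ∀ c {x y} → Θ x y → Θ (x · c) (y · c)
      Θ-r c Θ-refl          = Θ-refl
      Θ-r c (Θ-base s h)    = Θ-base s (cg-r c h)
      Θ-r c (Θ-trans h h')  = Θ-trans (Θ-r c h) (Θ-r c h')

  J⊥ : Pred Carrier a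
  J⊥ = kernel Θ-isCongruence

  -- For z ∈ J, z ⊓ c and z ⊓ c' lie in J below z and are congruent modulo
  -- each Cg(u), so a separating u forces them to be equal.
  ⊓-invariant : ∀ {z c c'} → J z → Θ c c' → z ⊓ c ≡ z ⊓ c'
  ⊓-invariant z∈J Θ-refl = refl
  ⊓-invariant {z} z∈J (Θ-base {u} separating h) =
    separating (⊓-congʳ Cg-isCongruence z h)
               (downward-closed (⊓-lowerˡ z _) z∈J) (downward-closed (⊓-lowerˡ z _) z∈J)
  ⊓-invariant z∈J (Θ-trans h h') = trans (⊓-invariant z∈J h) (⊓-invariant z∈J h')

  J⊥-meet : MeetIsZero A J J⊥
  J⊥-meet z z∈J z∈J⊥ = trans (sym (⊓-idem z)) (trans (⊓-invariant z∈J z∈J⊥) (⊓-zeroʳ z))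

  -- If K ∩ J = {0}, then θ_K identifies no two distinct elements of J:
  -- pᵅq and qᵅp lie in K and (by left absorption) in J, hence are 0.
  θ-separates : ∀ {K : Pred Carrier a} (isK : IsIdeal A K) → MeetIsZero A J K →
                ∀ {p q} → IdealCongruence.θ A isK p q → J p → J q → p ≡ q
  θ-separates isK J∩K≡𝟘 {p} {q} (pᵅq∈K , qᵅp∈K) p∈J q∈J =
    residual-antisym-≡ (J∩K≡𝟘 _ (·-closedˡ (p ᵅ) q∈J) pᵅq∈K)
                       (J∩K≡𝟘 _ (·-closedˡ (q ᵅ) p∈J) qᵅp∈K)

  -- Every element of an ideal disjoint from J is separating, as Cg(u) ⊆ θ_K.
  J⊥-greatest : ∀ (K : Pred Carrier a) → IsIdeal A K → MeetIsZero A J K → ∀ {u} → K u → J⊥ u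
  J⊥-greatest K isK J∩K≡𝟘 u∈K = Θ-base separating generator
    where
      open IdealCongruence A isK using (θ-isCongruence; θ-ofElement)
      separating : Separating _
      separating h = θ-separates isK J∩K≡𝟘 (Cg-least θ-isCongruence (θ-ofElement u∈K) h)

theorem4 : {a : Level} (A : ŁukasiewiczNearSemiring a) →
    (J : Pred (ŁukasiewiczNearSemiring.Carrier A) a) → IsIdeal A J →
    Σ (Pred (ŁukasiewiczNearSemiring.Carrier A) a) (λ I → IsPseudocomplement A J I)
theorem4 A J isJ = J⊥ , kernel-isIdeal Θ-isCongruence , J⊥-meet , J⊥-greatest
  where
    open Pseudocomplement A J isJ
    open ŁukasiewiczFacts A using (kernel-isIdeal)
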